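{- Consider the online general knapsack problem with reservation in which the reservation cost of an item is proportional to its size, with reservation factor $0<\alpha\le 1$. For no constant $c<2$ is there an online algorithm $\mathtt{A}$ that is $c$-competitive in the non-strict sense; that is, for every online algorithm $\mathtt{A}$, every $c<2$ and every constant $\beta>0$ there is a request sequence $S$ with ${\rm gain}_{\mathtt{OPT}}(S)> c\cdot {\rm gain}_{\mathtt{A}}(S)+\beta$.
   Context: Online general knapsack with reservation: the knapsack has capacity $1$. Items $x=(s_x,v_x)$ with size $0<s_x\le 1$ and value $v_x> 0$ arrive one by one. When an item arrives, a (deterministic) online algorithm must immediately and irrevocably either pack it, reject it, or reserve it. After the whole sequence has arrived, the algorithm may pack any subset of the reserved items that fits into the knapsack together with the already packed items (total size at most $1$). Every reserved item incurs a reservation cost, paid regardless of whether the item is finally packed; here the cost of reserving $x$ is $\alpha\cdot s_x$. The gain of an algorithm on a sequence $S$ is the total value of packed items minus the total reservation costs; ${\rm gain}_{\mathtt{OPT}}(S)$ is the maximum total value of a subset of items of $S$ of total size at most $1$.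
   Formalization: The reservation factor α, the constants c and β, and the sizes and values of all items, both those an algorithm receives and those of the request sequence, are rational. -}

module Defs where

open import Data.Nat using (ℕ; zero; suc)
open import Data.Bool using (Bool; true; false)
open import Data.List using (List; []; _∷_; _++_; [_]; map; foldr; filter)
import Relation.Nullary
open import Data.Rational using (ℚ; 0ℚ; 1ℚ; _+_; _-_; _*_; _≤_; _<_; _⊔_; _≤?_)

record Item : Set where
  constructor item
  field
    size  : ℚ
    value : ℚ
    size-pos : 0ℚ < size
    size≤1   : size ≤ 1ℚ
    value-pos : 0ℚ < value
open Item public

data Decision : Set where
  pack reject reserve : Decision

-- A deterministic online algorithm:
--  * decide h x : decision for the arriving item x, given the list h of
--    previously arrived items (in arrival order); the algorithm's own
--    earlier decisions are a function of h, so this is fully general.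
--  * final S i : after the whole sequence S has arrived, whether the
--    i-th item (0-based) of S is finally packed, if it was reserved.
record Algorithm : Set where
  field
    decide : List Item → Item → Decision
    final  : List Item → ℕ → Bool
open Algorithm public

decisionsFrom : Algorithm → List Item → List Item → List Decision
decisionsFrom A h [] = []
decisionsFrom A h (x ∷ xs) = decide A h x ∷ decisionsFrom A (h ++ [ x ]) xs

decisions : Algorithm → List Item → List Decision
decisions A S = decisionsFrom A [] S

packedAux : (ℕ → Bool) → ℕ → List Item → List Decision → List Item
packedAux f i (x ∷ xs) (pack ∷ ds)    = x ∷ packedAux f (suc i) xs ds
packedAux f i (x ∷ xs) (reject ∷ ds)  = packedAux f (suc i) xs ds
packedAux f i (x ∷ xs) (reserve ∷ ds) with f i
... | true  = x ∷ packedAux f (suc i) xs ds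
... | false = packedAux f (suc i) xs ds
packedAux f i _ _ = []

packedItems : Algorithm → List Item → List Item
packedItems A S = packedAux (final A S) 0 S (decisions A S)

reservedAux : List Item → List Decision → List Item
reservedAux (x ∷ xs) (reserve ∷ ds) = x ∷ reservedAux xs ds
reservedAux (x ∷ xs) (_ ∷ ds)       = reservedAux xs ds
reservedAux _ _ = []

reservedItems : Algorithm → List Item → List Item
reservedItems A S = reservedAux S (decisions A S)

totalSize : List Item → ℚ
totalSize = foldr (λ x r → size x + r) 0ℚ

totalValue : List Item → ℚ
totalValue = foldr (λ x r → value x + r) 0ℚ

-- A is a valid (feasible) algorithm: on every sequence, the items it
-- ends up packing fit into the knapsack of capacity 1.  (Since sizes are
-- positive, this also guarantees every online pack fit at its time.)
Valid : Algorithm → Set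
Valid A = ∀ (S : List Item) → totalSize (packedItems A S) ≤ 1ℚ

gain : ℚ → Algorithm → List Item → ℚ
gain α A S = totalValue (packedItems A S) - α * totalSize (reservedItems A S)

sublists : List Item → List (List Item)
sublists [] = [] ∷ []
sublists (x ∷ xs) = let r = sublists xs in map (x ∷_) r ++ r

optGain : List Item → ℚ
optGain S = foldr (λ T r → feasibleValue T ⊔ r) 0ℚ (sublists S)
  where
  feasibleValue : List Item → ℚ
  feasibleValue T with totalSize T ≤? 1ℚ
  ... | Relation.Nullary.yes _ = totalValue T
  ... | Relation.Nullary.no _  = 0ℚ

{-# OPTIONS --safe #-}

-- The adversary offers items X₀, X₁, … of value V and sizes ½ + δ₀ > ½ + δ₁ > …, any two of which
-- overflow the knapsack. While the algorithm reserves them it can keep at most one, so once their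
-- total size reaches V/α the reservation cost cancels everything it gains, whereas OPT ≥ V. If instead
-- X_n is rejected, the adversary adds F_n of size ½ − δ_n, which fits only next to X_n; if X_n is
-- packed, it adds an item of size 1 and value 2V. Either way OPT ≥ 2V while the algorithm keeps at
-- most V, as every earlier X_j is too big to share the knapsack with X_n or F_n. Taking V large
-- compared with β/(2 − c) then beats c·gain + β. For c ≤ 0 a single item of size 1 and value
-- β − c + 1 suffices, the gain being at least −α ≥ −1.

module Submission where

open import Defs
open import Data.List using (List)
open import Data.Product using (∃-syntax)
open import Data.Rational using (ℚ; 0ℚ; 1ℚ; _+_; _*_; _≤_; _<_; _>_)

open import Data.Bool using (Bool; true; false)
open import Data.Nat as ℕ using (ℕ; zero; suc)
import Data.Nat.Properties as ℕ
import Data.Integer as ℤ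
import Data.Integer.Properties as ℤ
import Data.Integer.Solver
open import Data.Rational
  using (mkℚ; toℚᵘ; _-_; -_; ½; 1/_; ↥_; ↧_; *<*; NonZero; positive; nonNegative; nonPositive)
open import Data.Rational.Properties
import Data.Rational.Solver
import Data.Rational.Unnormalised as ℚᵘ
import Data.Rational.Unnormalised.Properties as ℚᵘ
open import Data.Product using (Σ-syntax; ∃₂; _,_; _×_; proj₁)
open import Data.Sum using (_⊎_; inj₁; inj₂; [_,_]′)
open import Data.List using ([]; _∷_; _++_; [_]; map; foldr; length)
open import Data.List.Properties using (++-identityʳ; ++-assoc; map-++)
open import Data.List.Membership.Propositional using (_∈_)
open import Data.List.Membership.Propositional.Properties using (∈-++⁺ˡ; ∈-++⁺ʳ; ∈-map⁺)
open import Data.List.Relation.Unary.Any using (here; there)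
open import Data.List.Relation.Unary.All as All using (All; []; _∷_)
import Data.List.Relation.Unary.All.Properties as All
open import Data.List.Relation.Binary.Sublist.Propositional using (_⊆_; []; _∷_; _∷ʳ_; ⊆-refl; minimum)
import Data.List.Relation.Binary.Sublist.Propositional.Properties as Sublist
open import Relation.Nullary using (yes; no; ¬_; contradiction)
open import Relation.Binary.PropositionalEquality using (_≡_; refl; sym; trans; cong; cong₂; subst₂)

open ≤-Reasoning

p<p+q : ∀ p {q} → 0ℚ < q → p < p + q
p<p+q p {q} 0<q = begin-strict
  p      ≡⟨ +-identityʳ p ⟨
  p + 0ℚ <⟨ +-monoʳ-< p 0<q ⟩
  p + q  ∎

p<q⇒0<q-p : ∀ {p q} → p < q → 0ℚ < q - p
p<q⇒0<q-p {p} {q} p<q = begin-strict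
  0ℚ    ≡⟨ +-inverseʳ p ⟨
  p - p <⟨ +-monoˡ-< (- p) p<q ⟩
  q - p ∎

p-q≤p : ∀ p {q} → 0ℚ ≤ q → p - q ≤ p
p-q≤p p {q} 0≤q = begin
  p - q  ≤⟨ +-monoʳ-≤ p (neg-antimono-≤ 0≤q) ⟩
  p + 0ℚ ≡⟨ +-identityʳ p ⟩
  p      ∎

*-pos : ∀ {p q} → 0ℚ < p → 0ℚ < q → 0ℚ < p * q
*-pos {p} {q} 0<p 0<q = positive⁻¹ (p * q) {{pos*pos⇒pos p {{positive 0<p}} q {{positive 0<q}}}}

*-nonNeg : ∀ {p q} → 0ℚ ≤ p → 0ℚ ≤ q → 0ℚ ≤ p * q
*-nonNeg {p} {q} 0≤p 0≤q = nonNegative⁻¹ (p * q) {{nonNeg*nonNeg⇒nonNeg p {{nonNegative 0≤p}} q {{nonNegative 0≤q}}}}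

fromℕ : ℕ → ℚ
fromℕ zero    = 0ℚ
fromℕ (suc n) = fromℕ n + 1ℚ

toℚᵘ-fromℕ : ∀ n → toℚᵘ (fromℕ n) ℚᵘ.≃ ℚᵘ.mkℚᵘ (ℤ.+ n) 0
toℚᵘ-fromℕ zero    = ℚᵘ.≃-refl
toℚᵘ-fromℕ (suc n) = ℚᵘ.≃-trans (toℚᵘ-homo-+ (fromℕ n) 1ℚ)
  (ℚᵘ.≃-trans (ℚᵘ.+-congˡ ℚᵘ.1ℚᵘ (toℚᵘ-fromℕ n)) (ℚᵘ.*≡* (solve 1
    (λ i → (i :* con (ℤ.+ 1) :+ con (ℤ.+ 1) :* con (ℤ.+ 1)) :* con (ℤ.+ 1) := (con (ℤ.+ 1) :+ i) :* con (ℤ.+ 1))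
    refl (ℤ.+ n))))
  where open Data.Integer.Solver.+-*-Solver

archimedean : ∀ q → ∃[ n ] q ≤ fromℕ n
archimedean (mkℚ i d _) =
  ℤ.∣ i ∣ , toℚᵘ-cancel-≤ (ℚᵘ.≤-respʳ-≃ (ℚᵘ.≃-sym (toℚᵘ-fromℕ ℤ.∣ i ∣)) (ℚᵘ.*≤* (i≤∣i∣*d i)))
  where
  i≤∣i∣*d : ∀ i → i ℤ.* ℤ.+ 1 ℤ.≤ ℤ.+ ℤ.∣ i ∣ ℤ.* ℤ.+ suc d
  i≤∣i∣*d ℤ.-[1+ k ] = ℤ.-≤+
  i≤∣i∣*d (ℤ.+ k)    =
    subst₂ ℤ._≤_ (sym (ℤ.*-identityʳ (ℤ.+ k))) (ℤ.pos-* k (suc d)) (ℤ.+≤+ (ℕ.m≤m*n k (suc d)))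

totalSize-++ : ∀ xs ys → totalSize (xs ++ ys) ≡ totalSize xs + totalSize ys
totalSize-++ []       ys = sym (+-identityˡ (totalSize ys))
totalSize-++ (x ∷ xs) ys = trans (cong (size x +_) (totalSize-++ xs ys)) (sym (+-assoc (size x) _ _))

totalSize-nonNeg : ∀ xs → 0ℚ ≤ totalSize xs
totalSize-nonNeg []       = ≤-refl
totalSize-nonNeg (x ∷ xs) = +-mono-≤ (<⇒≤ (size-pos x)) (totalSize-nonNeg xs)

totalValue-nonNeg : ∀ xs → 0ℚ ≤ totalValue xs
totalValue-nonNeg []       = ≤-refl
totalValue-nonNeg (x ∷ xs) = +-mono-≤ (<⇒≤ (value-pos x)) (totalValue-nonNeg xs)

totalSize-mono-⊆ : ∀ {xs ys} → xs ⊆ ys → totalSize xs ≤ totalSize ys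
totalSize-mono-⊆ []                           = ≤-refl
totalSize-mono-⊆ {x ∷ _} (refl ∷ xs⊆ys)        = +-monoʳ-≤ (size x) (totalSize-mono-⊆ xs⊆ys)
totalSize-mono-⊆ {xs} {y ∷ ys} (.y ∷ʳ xs⊆ys) = begin
  totalSize xs           ≡⟨ +-identityˡ (totalSize xs) ⟨
  0ℚ + totalSize xs      ≤⟨ +-mono-≤ (<⇒≤ (size-pos y)) (totalSize-mono-⊆ xs⊆ys) ⟩
  size y + totalSize ys  ∎

conflicting-pair-overflows : ∀ {x y P} → x ∷ y ∷ [] ⊆ P → 1ℚ < size x + size y → ¬ totalSize P ≤ 1ℚ
conflicting-pair-overflows {x} {y} {P} xy⊆P 1<x+y P≤1 = <-irrefl refl (begin-strict
  1ℚ                      <⟨ 1<x+y ⟩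
  size x + size y         ≡⟨ cong (size x +_) (+-identityʳ (size y)) ⟨
  totalSize (x ∷ y ∷ [])  ≤⟨ totalSize-mono-⊆ xy⊆P ⟩
  totalSize P             ≤⟨ P≤1 ⟩
  1ℚ                      ∎)

sizes>½⇒totalValue≤ : ∀ {V P} → 0ℚ ≤ V → All (λ x → ½ < size x × value x ≤ V) P →
  totalSize P ≤ 1ℚ → totalValue P ≤ V
sizes>½⇒totalValue≤ 0≤V []                 _   = 0≤V
sizes>½⇒totalValue≤ _   ((_ , x≤V) ∷ [])   _   = ≤-trans (≤-reflexive (+-identityʳ _)) x≤V
sizes>½⇒totalValue≤ {P = x ∷ y ∷ P} _ ((½<x , _) ∷ (½<y , _) ∷ _) P≤1 =
  contradiction P≤1 (conflicting-pair-overflows {x} {y} (refl ∷ refl ∷ minimum P) (+-mono-< ½<x ½<y))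

-- The step function of optGain is local to its definition; unification recovers it.
optGain-fold : Σ[ step ∈ (List Item → List Item → ℚ → ℚ) ]
  (∀ S → optGain S ≡ foldr (step S) 0ℚ (sublists S))
optGain-fold = _ , λ _ → refl

optGainStep : List Item → List Item → ℚ → ℚ
optGainStep = proj₁ optGain-fold

-- The test `totalSize T ≤? 1ℚ` in optGain unfolds to this comparison of integers.
optGainStep-≥ʳ : ∀ S T r → r ≤ optGainStep S T r
optGainStep-≥ʳ S T r with ↥ totalSize T ℤ.* ↧ 1ℚ ℤ.≤? ↥ 1ℚ ℤ.* ↧ totalSize T
... | yes _ = p≤q⊔p (totalValue T) r
... | no _  = p≤q⊔p 0ℚ r

fits⇒optGainStep-≥ : ∀ S {T} r → totalSize T ≤ 1ℚ → totalValue T ≤ optGainStep S T r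
fits⇒optGainStep-≥ S {T} r T≤1 with ↥ totalSize T ℤ.* ↧ 1ℚ ℤ.≤? ↥ 1ℚ ℤ.* ↧ totalSize T
... | yes _   = p≤p⊔q (totalValue T) r
... | no T≰1 = contradiction (drop-*≤* T≤1) T≰1

fits-∈⇒totalValue≤foldr : ∀ S {T Ts} → T ∈ Ts → totalSize T ≤ 1ℚ →
  totalValue T ≤ foldr (optGainStep S) 0ℚ Ts
fits-∈⇒totalValue≤foldr S {T} {_ ∷ Ts} (here refl) T≤1 =
  fits⇒optGainStep-≥ S {T} (foldr (optGainStep S) 0ℚ Ts) T≤1
fits-∈⇒totalValue≤foldr S {Ts = U ∷ _} (there T∈Ts) T≤1 =
  ≤-trans (fits-∈⇒totalValue≤foldr S T∈Ts T≤1) (optGainStep-≥ʳ S U _)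

⊆⇒∈-sublists : ∀ {T S} → T ⊆ S → T ∈ sublists S
⊆⇒∈-sublists []                       = here refl
⊆⇒∈-sublists {S = y ∷ S} (.y ∷ʳ T⊆S) = ∈-++⁺ʳ (map (y ∷_) (sublists S)) (⊆⇒∈-sublists T⊆S)
⊆⇒∈-sublists {x ∷ _} (refl ∷ T⊆S)    = ∈-++⁺ˡ (∈-map⁺ (x ∷_) (⊆⇒∈-sublists T⊆S))

fits⇒totalValue≤optGain : ∀ {T S} → T ⊆ S → totalSize T ≤ 1ℚ → totalValue T ≤ optGain S
fits⇒totalValue≤optGain {S = S} T⊆S = fits-∈⇒totalValue≤foldr S (⊆⇒∈-sublists T⊆S)

decisionsFrom-++ : ∀ A h xs ys →
  decisionsFrom A h (xs ++ ys) ≡ decisionsFrom A h xs ++ decisionsFrom A (h ++ xs) ys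
decisionsFrom-++ A h []       ys = cong (λ h′ → decisionsFrom A h′ ys) (sym (++-identityʳ h))
decisionsFrom-++ A h (x ∷ xs) ys = cong (decide A h x ∷_) (trans
  (decisionsFrom-++ A (h ++ [ x ]) xs ys)
  (cong (λ h′ → decisionsFrom A (h ++ [ x ]) xs ++ decisionsFrom A h′ ys) (++-assoc h [ x ] xs)))

length-decisionsFrom : ∀ A h xs → length (decisionsFrom A h xs) ≡ length xs
length-decisionsFrom A h []       = refl
length-decisionsFrom A h (x ∷ xs) = cong suc (length-decisionsFrom A (h ++ [ x ]) xs)

packedAux-⊆ : ∀ f i xs ds → packedAux f i xs ds ⊆ xs
packedAux-⊆ f i []       ds              = []
packedAux-⊆ f i (x ∷ xs) []              = minimum (x ∷ xs)
packedAux-⊆ f i (x ∷ xs) (pack ∷ ds)    = refl ∷ packedAux-⊆ f (suc i) xs ds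
packedAux-⊆ f i (x ∷ xs) (reject ∷ ds)  = x ∷ʳ packedAux-⊆ f (suc i) xs ds
packedAux-⊆ f i (x ∷ xs) (reserve ∷ ds) with f i
... | true  = refl ∷ packedAux-⊆ f (suc i) xs ds
... | false = x ∷ʳ packedAux-⊆ f (suc i) xs ds

packedAux-++ : ∀ f i xs ds ys es → length xs ≡ length ds →
  ∃[ j ] packedAux f i (xs ++ ys) (ds ++ es) ≡ packedAux f i xs ds ++ packedAux f j ys es
packedAux-++ f i []       []             ys es _  = i , refl
packedAux-++ f i (x ∷ xs) (pack ∷ ds)    ys es eq =
  let j , split = packedAux-++ f (suc i) xs ds ys es (ℕ.suc-injective eq) in j , cong (x ∷_) split
packedAux-++ f i (x ∷ xs) (reject ∷ ds)  ys es eq = packedAux-++ f (suc i) xs ds ys es (ℕ.suc-injective eq)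
packedAux-++ f i (x ∷ xs) (reserve ∷ ds) ys es eq with f i
... | true  = let j , split = packedAux-++ f (suc i) xs ds ys es (ℕ.suc-injective eq) in j , cong (x ∷_) split
... | false = packedAux-++ f (suc i) xs ds ys es (ℕ.suc-injective eq)

packedItems-++ : ∀ A xs ys → ∃₂ λ P j →
  P ⊆ xs × packedItems A (xs ++ ys) ≡ P ++ packedAux (final A (xs ++ ys)) j ys (decisionsFrom A xs ys)
packedItems-++ A xs ys =
  let j , split = packedAux-++ f 0 xs (decisions A xs) ys (decisionsFrom A xs ys)
                    (sym (length-decisionsFrom A [] xs))
  in packedAux f 0 xs (decisions A xs) , j , packedAux-⊆ f 0 xs (decisions A xs) ,
     trans (cong (packedAux f 0 (xs ++ ys)) (decisionsFrom-++ A [] xs ys)) split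
  where
  f : ℕ → Bool
  f = final A (xs ++ ys)

packedItems-after-reject : ∀ A xs {x y} → decide A xs x ≡ reject →
  ∃₂ λ P Q → P ⊆ xs × Q ⊆ [ y ] × packedItems A (xs ++ x ∷ y ∷ []) ≡ P ++ Q
packedItems-after-reject A xs {x} {y} rejected =
  let P , j , P⊆xs , split = packedItems-++ A xs (x ∷ y ∷ []) in
  P , packedAux f (suc j) [ y ] d , P⊆xs , packedAux-⊆ f (suc j) [ y ] d ,
  trans split (cong (λ dₓ → P ++ packedAux f j (x ∷ y ∷ []) (dₓ ∷ d)) rejected)
  where
  f : ℕ → Bool
  f = final A (xs ++ x ∷ y ∷ [])
  d : List Decision
  d = decisionsFrom A (xs ++ [ x ]) [ y ]

packedItems-after-pack : ∀ A xs {x y} → decide A xs x ≡ pack →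
  ∃₂ λ P Q → P ⊆ xs × Q ⊆ [ y ] × packedItems A (xs ++ x ∷ y ∷ []) ≡ P ++ x ∷ Q
packedItems-after-pack A xs {x} {y} packed =
  let P , j , P⊆xs , split = packedItems-++ A xs (x ∷ y ∷ []) in
  P , packedAux f (suc j) [ y ] d , P⊆xs , packedAux-⊆ f (suc j) [ y ] d ,
  trans split (cong (λ dₓ → P ++ packedAux f j (x ∷ y ∷ []) (dₓ ∷ d)) packed)
  where
  f : ℕ → Bool
  f = final A (xs ++ x ∷ y ∷ [])
  d : List Decision
  d = decisionsFrom A (xs ++ [ x ]) [ y ]

ReservesAll : Algorithm → List Item → Set
ReservesAll A xs = decisions A xs ≡ map (λ _ → reserve) xs

reservesAll-∷ʳ : ∀ A xs {x} → ReservesAll A xs → decide A xs x ≡ reserve →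
  ReservesAll A (xs ++ [ x ])
reservesAll-∷ʳ A xs {x} all-reserved reserved = trans (decisionsFrom-++ A [] xs [ x ]) (trans
  (cong₂ (λ ds d → ds ++ [ d ]) all-reserved reserved)
  (sym (map-++ (λ _ → reserve) xs [ x ])))

reservedAux-⊆ : ∀ xs ds → reservedAux xs ds ⊆ xs
reservedAux-⊆ []       ds              = []
reservedAux-⊆ (x ∷ xs) []              = minimum (x ∷ xs)
reservedAux-⊆ (x ∷ xs) (reserve ∷ ds) = refl ∷ reservedAux-⊆ xs ds
reservedAux-⊆ (x ∷ xs) (pack ∷ ds)    = x ∷ʳ reservedAux-⊆ xs ds
reservedAux-⊆ (x ∷ xs) (reject ∷ ds)  = x ∷ʳ reservedAux-⊆ xs ds

reservedAux-reserveAll : ∀ xs → reservedAux xs (map (λ _ → reserve) xs) ≡ xs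
reservedAux-reserveAll []       = refl
reservedAux-reserveAll (x ∷ xs) = cong (x ∷_) (reservedAux-reserveAll xs)

reservesAll⇒reservedItems≡ : ∀ A xs → ReservesAll A xs → reservedItems A xs ≡ xs
reservesAll⇒reservedItems≡ A xs all-reserved =
  trans (cong (reservedAux xs) all-reserved) (reservedAux-reserveAll xs)

gain≤totalValue : ∀ {α} A S → 0ℚ ≤ α → gain α A S ≤ totalValue (packedItems A S)
gain≤totalValue A S 0≤α = p-q≤p _ (*-nonNeg 0≤α (totalSize-nonNeg (reservedItems A S)))

gain≥-α*totalSize : ∀ {α} A S → 0ℚ ≤ α → - (α * totalSize S) ≤ gain α A S
gain≥-α*totalSize {α} A S 0≤α = begin
  - (α * totalSize S)
    ≡⟨ +-identityˡ _ ⟨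
  0ℚ - α * totalSize S
    ≤⟨ +-mono-≤ (totalValue-nonNeg (packedItems A S)) (neg-antimono-≤ reservation≤) ⟩
  totalValue (packedItems A S) - α * totalSize (reservedItems A S) ∎
  where
  reservation≤ : α * totalSize (reservedItems A S) ≤ α * totalSize S
  reservation≤ = *-monoˡ-≤-nonNeg α {{nonNegative 0≤α}} (totalSize-mono-⊆ (reservedAux-⊆ S (decisions A S)))

packedItems≡⇒gain≤ : ∀ {α V} A S {P} → Valid A → 0ℚ ≤ α → packedItems A S ≡ P →
  (totalSize P ≤ 1ℚ → totalValue P ≤ V) → gain α A S ≤ V
packedItems≡⇒gain≤ A S valid 0≤α refl bound = ≤-trans (gain≤totalValue A S 0≤α) (bound (valid S))

½<1 : ½ < 1ℚ
½<1 = *<* (ℤ.+<+ (ℕ.s≤s (ℕ.s≤s ℕ.z≤n)))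

p*½<p : ∀ {p} → 0ℚ < p → p * ½ < p
p*½<p {p} 0<p = begin-strict
  p * ½   <⟨ *-monoʳ-<-pos p {{positive 0<p}} ½<1 ⟩
  p * 1ℚ  ≡⟨ *-identityʳ p ⟩
  p       ∎

δ : ℕ → ℚ
δ zero    = ½ * ½
δ (suc n) = δ n * ½

δ-pos : ∀ n → 0ℚ < δ n
δ-pos zero    = *-pos (positive⁻¹ ½) (positive⁻¹ ½)
δ-pos (suc n) = *-pos (δ-pos n) (positive⁻¹ ½)

δ-suc< : ∀ n → δ (suc n) < δ n
δ-suc< n = p*½<p (δ-pos n)

δ<½ : ∀ n → δ n < ½
δ<½ zero    = p*½<p (positive⁻¹ ½)
δ<½ (suc n) = <-trans (δ-suc< n) (δ<½ n)

module Adversary (V : ℚ) (0<V : 0ℚ < V) where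

  X : ℕ → Item
  X n = item (½ + δ n) V (<-trans (positive⁻¹ ½) (p<p+q ½ (δ-pos n))) (+-monoʳ-≤ ½ (<⇒≤ (δ<½ n))) 0<V

  F : ℕ → Item
  F n = item (½ - δ n) V (p<q⇒0<q-p (δ<½ n)) (≤-trans (p-q≤p ½ (<⇒≤ (δ-pos n))) (<⇒≤ ½<1)) 0<V

  H : Item
  H = item 1ℚ (V + V) (positive⁻¹ 1ℚ) ≤-refl (+-mono-< 0<V 0<V)

  chain : ℕ → List Item
  chain zero    = []
  chain (suc n) = chain n ++ [ X n ]

  chain-items : ∀ n → All (λ x → ½ + δ n < size x × value x ≤ V) (chain n)
  chain-items zero    = []
  chain-items (suc n) =
    All.++⁺ (All.map (λ (δₙ< , ≤V) → <-trans ½+δ-suc< δₙ< , ≤V) (chain-items n)) ((½+δ-suc< , ≤-refl) ∷ [])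
    where
    ½+δ-suc< : ½ + δ (suc n) < ½ + δ n
    ½+δ-suc< = +-monoʳ-< ½ (δ-suc< n)

  totalSize-chain : ∀ n → fromℕ n * ½ ≤ totalSize (chain n)
  totalSize-chain zero    = ≤-refl
  totalSize-chain (suc n) = begin
    (fromℕ n + 1ℚ) * ½
      ≡⟨ solve 1 (λ m → (m :+ con 1ℚ) :* con ½ := m :* con ½ :+ (con ½ :+ con 0ℚ)) refl (fromℕ n) ⟩
    fromℕ n * ½ + (½ + 0ℚ)
      ≤⟨ +-mono-≤ (totalSize-chain n) (+-monoˡ-≤ 0ℚ (<⇒≤ (p<p+q ½ (δ-pos n)))) ⟩
    totalSize (chain n) + totalSize [ X n ]
      ≡⟨ totalSize-++ (chain n) [ X n ] ⟨
    totalSize (chain (suc n)) ∎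
    where open Data.Rational.Solver.+-*-Solver

  chain-unbounded : ∀ q → ∃[ n ] q ≤ totalSize (chain n)
  chain-unbounded q = let n , 2q≤n = archimedean (q + q) in n , (begin
    q                    ≡⟨ solve 1 (λ q → q := (q :+ q) :* con ½) refl q ⟩
    (q + q) * ½          ≤⟨ *-monoʳ-≤-nonNeg ½ 2q≤n ⟩
    fromℕ n * ½          ≤⟨ totalSize-chain n ⟩
    totalSize (chain n)  ∎)
    where open Data.Rational.Solver.+-*-Solver

  chain-packing : ∀ {n P} → P ⊆ chain n → totalSize P ≤ 1ℚ → totalValue P ≤ V
  chain-packing {n} P⊆chain = sizes>½⇒totalValue≤ (<⇒≤ 0<V)
    (All.map (λ (δₙ< , ≤V) → <-trans (p<p+q ½ (δ-pos n)) δₙ< , ≤V)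
      (Sublist.All-resp-⊆ P⊆chain (chain-items n)))

  packing-after-reject : ∀ {n P Q} → P ⊆ chain n → Q ⊆ [ F n ] →
    totalSize (P ++ Q) ≤ 1ℚ → totalValue (P ++ Q) ≤ V
  packing-after-reject {n} P⊆chain (_ ∷ʳ []) = chain-packing {suc n} (Sublist.++⁺ P⊆chain (minimum [ X n ]))
  packing-after-reject {P = []} _ (refl ∷ []) _ = ≤-reflexive (+-identityʳ V)
  packing-after-reject {n} {y ∷ P} P⊆chain (refl ∷ []) fits =
    contradiction fits (conflicting-pair-overflows {y} {F n} (refl ∷ Sublist.++⁺ˡ P ⊆-refl) 1<y+F)
    where
    open Data.Rational.Solver.+-*-Solver
    δₙ<y : ½ + δ n < size y
    δₙ<y = proj₁ (All.head (Sublist.All-resp-⊆ P⊆chain (chain-items n)))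
    1<y+F : 1ℚ < size y + (½ - δ n)
    1<y+F = begin-strict
      1ℚ                        ≡⟨ solve 1 (λ d → con 1ℚ := (con ½ :+ d) :+ (con ½ :- d)) refl (δ n) ⟩
      (½ + δ n) + (½ - δ n)     <⟨ +-monoˡ-< (½ - δ n) δₙ<y ⟩
      size y + (½ - δ n)        ∎

  packing-after-pack : ∀ {n P Q} → P ⊆ chain n → Q ⊆ [ H ] →
    totalSize (P ++ X n ∷ Q) ≤ 1ℚ → totalValue (P ++ X n ∷ Q) ≤ V
  packing-after-pack {n} P⊆chain (_ ∷ʳ []) = chain-packing {suc n} (Sublist.++⁺ P⊆chain ⊆-refl)
  packing-after-pack {n} {P} _ (refl ∷ []) fits =
    contradiction fits (conflicting-pair-overflows (Sublist.++⁺ˡ P ⊆-refl) (begin-strict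
      1ℚ               ≡⟨ +-identityˡ 1ℚ ⟨
      0ℚ + 1ℚ          <⟨ +-monoˡ-< 1ℚ (size-pos (X n)) ⟩
      size (X n) + 1ℚ  ∎))

  optGain-chain : ∀ n → V ≤ optGain (chain (suc n))
  optGain-chain n = ≤-trans (≤-reflexive (sym (+-identityʳ V)))
    (fits⇒totalValue≤optGain (Sublist.++⁺ˡ (chain n) ⊆-refl) (≤-trans (≤-reflexive (+-identityʳ _)) (size≤1 (X n))))

  optGain-after-reject : ∀ n → V + V ≤ optGain (chain n ++ X n ∷ F n ∷ [])
  optGain-after-reject n = ≤-trans (≤-reflexive (cong (V +_) (sym (+-identityʳ V))))
    (fits⇒totalValue≤optGain (Sublist.++⁺ˡ (chain n) ⊆-refl) (≤-reflexive
      (solve 1 (λ d → (con ½ :+ d) :+ ((con ½ :- d) :+ con 0ℚ) := con 1ℚ) refl (δ n))))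
    where open Data.Rational.Solver.+-*-Solver

  optGain-after-pack : ∀ n → V + V ≤ optGain (chain n ++ X n ∷ H ∷ [])
  optGain-after-pack n = ≤-trans (≤-reflexive (sym (+-identityʳ (V + V))))
    (fits⇒totalValue≤optGain (Sublist.++⁺ˡ (chain n) (X n ∷ʳ ⊆-refl)) ≤-refl)

  reservationCost-unbounded : ∀ {α} → 0ℚ < α → ∃[ n ] V ≤ α * totalSize (chain n)
  reservationCost-unbounded {α} 0<α = let n , V/α≤ = chain-unbounded (V * α⁻¹) in n , (begin
    V                        ≡⟨ *-identityʳ V ⟨
    V * 1ℚ                   ≡⟨ cong (V *_) (*-inverseʳ α {{α≢0}}) ⟨
    V * (α * α⁻¹)            ≡⟨ solve 3 (λ v a b → v :* (a :* b) := a :* (v :* b)) refl V α α⁻¹ ⟩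
    α * (V * α⁻¹)            ≤⟨ *-monoˡ-≤-nonNeg α {{nonNegative (<⇒≤ 0<α)}} V/α≤ ⟩
    α * totalSize (chain n)  ∎)
    where
    open Data.Rational.Solver.+-*-Solver
    α≢0 : NonZero α
    α≢0 = pos⇒nonZero α {{positive 0<α}}
    α⁻¹ : ℚ
    α⁻¹ = (1/ α) {{α≢0}}

  module _ (A : Algorithm) where

    Stops : ℕ → Set
    Stops n = decide A (chain n) (X n) ≡ pack ⊎ decide A (chain n) (X n) ≡ reject

    reservesAll-or-stops : ∀ N → ReservesAll A (chain N) ⊎ ∃[ n ] Stops n
    reservesAll-or-stops zero = inj₁ refl
    reservesAll-or-stops (suc N) with reservesAll-or-stops N
    ... | inj₂ stop = inj₂ stop
    ... | inj₁ all-reserved with decide A (chain N) (X N) in d≡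
    ...   | pack    = inj₂ (N , inj₁ d≡)
    ...   | reject  = inj₂ (N , inj₂ d≡)
    ...   | reserve = inj₁ (reservesAll-∷ʳ A (chain N) all-reserved d≡)

    module _ (valid : Valid A) {α : ℚ} (0<α : 0ℚ < α) where

      private
        0≤α : 0ℚ ≤ α
        0≤α = <⇒≤ 0<α

      gain-after-reject : ∀ n → decide A (chain n) (X n) ≡ reject → gain α A (chain n ++ X n ∷ F n ∷ []) ≤ V
      gain-after-reject n rejected =
        let _ , _ , P⊆chain , Q⊆F , packed≡ = packedItems-after-reject A (chain n) rejected
        in packedItems≡⇒gain≤ A (chain n ++ X n ∷ F n ∷ []) valid 0≤α packed≡
             (packing-after-reject {n} P⊆chain Q⊆F)

      gain-after-pack : ∀ n → decide A (chain n) (X n) ≡ pack → gain α A (chain n ++ X n ∷ H ∷ []) ≤ V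
      gain-after-pack n packed =
        let _ , _ , P⊆chain , Q⊆H , packed≡ = packedItems-after-pack A (chain n) packed
        in packedItems≡⇒gain≤ A (chain n ++ X n ∷ H ∷ []) valid 0≤α packed≡
             (packing-after-pack {n} P⊆chain Q⊆H)

      gain-reservesAll : ∀ n → ReservesAll A (chain n) → V ≤ α * totalSize (chain n) → gain α A (chain n) ≤ 0ℚ
      gain-reservesAll n all-reserved V≤cost = begin
        totalValue (packedItems A S) - α * totalSize (reservedItems A S)
          ≡⟨ cong (λ R → totalValue (packedItems A S) - α * totalSize R)
                  (reservesAll⇒reservedItems≡ A S all-reserved) ⟩
        totalValue (packedItems A S) - α * totalSize S
          ≤⟨ +-mono-≤ (chain-packing {n} (packedAux-⊆ (final A S) 0 S (decisions A S)) (valid S))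
                      (neg-antimono-≤ V≤cost) ⟩
        V - V
          ≡⟨ +-inverseʳ V ⟩
        0ℚ ∎
        where
        S : List Item
        S = chain n

      Outcome : List Item → Set
      Outcome S = (gain α A S ≤ 0ℚ × V ≤ optGain S) ⊎ (gain α A S ≤ V × V + V ≤ optGain S)

      outcome : ∀ N → V ≤ α * totalSize (chain N) → ReservesAll A (chain N) ⊎ ∃[ n ] Stops n → ∃[ S ] Outcome S
      outcome _ _ (inj₂ (n , inj₁ packed)) =
        chain n ++ X n ∷ H ∷ [] , inj₂ (gain-after-pack n packed , optGain-after-pack n)
      outcome _ _ (inj₂ (n , inj₂ rejected)) =
        chain n ++ X n ∷ F n ∷ [] , inj₂ (gain-after-reject n rejected , optGain-after-reject n)
      outcome zero V≤cost (inj₁ _) =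
        contradiction (<-≤-trans 0<V (≤-trans V≤cost (≤-reflexive (*-zeroʳ α)))) (<-irrefl refl)
      outcome (suc n) V≤cost (inj₁ all-reserved) =
        chain (suc n) , inj₁ (gain-reservesAll (suc n) all-reserved V≤cost , optGain-chain n)

      adversary : ∃[ S ] Outcome S
      adversary =
        let N , V≤cost = reservationCost-unbounded 0<α in outcome N V≤cost (reservesAll-or-stops N)

value-scale : ∀ {c β} → c < 1ℚ + 1ℚ → 0ℚ < β → ∃[ V ] (0ℚ < V × β < V × c * V + β < V + V)
value-scale {c} {β} c<2 0<β = V , <-trans 0<β β<V , β<V , cV+β<2V
  where
  open Data.Rational.Solver.+-*-Solver
  ε : ℚ
  ε = (1ℚ + 1ℚ) - c
  0<ε : 0ℚ < ε
  0<ε = p<q⇒0<q-p c<2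
  ε≢0 : NonZero ε
  ε≢0 = pos⇒nonZero ε {{positive 0<ε}}
  ε⁻¹ : ℚ
  ε⁻¹ = (1/ ε) {{ε≢0}}
  V : ℚ
  V = β + β * ε⁻¹
  β<V : β < V
  β<V = p<p+q β (*-pos 0<β (positive⁻¹ ε⁻¹ {{1/pos⇒pos ε {{positive 0<ε}}}}))
  cV+β<2V : c * V + β < V + V
  cV+β<2V = begin-strict
    c * V + β                      <⟨ p<p+q (c * V + β) (*-pos 0<ε 0<β) ⟩
    c * V + β + ε * β
      ≡⟨ cong (λ t → c * V + t + ε * β) (trans (cong (β *_) (*-inverseʳ ε {{ε≢0}})) (*-identityʳ β)) ⟨
    c * V + β * (ε * ε⁻¹) + ε * β
      ≡⟨ solve 3 (λ c b e → let ε = (con 1ℚ :+ con 1ℚ) :- c; V = b :+ b :* e in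
                            c :* V :+ b :* (ε :* e) :+ ε :* b := V :+ V) refl c β ε⁻¹ ⟩
    V + V ∎

outcomes⇒c*g+β<o : ∀ {c β V g o} → 0ℚ ≤ c → β < V → c * V + β < V + V →
  (g ≤ 0ℚ × V ≤ o) ⊎ (g ≤ V × V + V ≤ o) → c * g + β < o
outcomes⇒c*g+β<o {c} {β} {V} {g} {o} 0≤c β<V _ (inj₁ (g≤0 , V≤o)) = begin-strict
  c * g + β   ≤⟨ +-monoˡ-≤ β (*-monoˡ-≤-nonNeg c {{nonNegative 0≤c}} g≤0) ⟩
  c * 0ℚ + β  ≡⟨ trans (cong (_+ β) (*-zeroʳ c)) (+-identityˡ β) ⟩
  β           <⟨ β<V ⟩
  V           ≤⟨ V≤o ⟩
  o           ∎
outcomes⇒c*g+β<o {c} {β} {V} {g} {o} 0≤c _ cV+β<2V (inj₂ (g≤V , 2V≤o)) = begin-strict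
  c * g + β   ≤⟨ +-monoˡ-≤ β (*-monoˡ-≤-nonNeg c {{nonNegative 0≤c}} g≤V) ⟩
  c * V + β   <⟨ cV+β<2V ⟩
  V + V       ≤⟨ 2V≤o ⟩
  o           ∎

nonPositive-ratio : ∀ {α} A → 0ℚ ≤ α → α ≤ 1ℚ → ∀ {c β} → c ≤ 0ℚ → 0ℚ < β →
  ∃[ S ] optGain S > c * gain α A S + β
nonPositive-ratio {α} A 0≤α α≤1 {c} {β} c≤0 0<β = [ Y ] , (begin-strict
  c * gain α A [ Y ] + β  ≤⟨ +-monoˡ-≤ β (*-monoˡ-≤-nonPos c {{nonPositive c≤0}} gain≥-1) ⟩
  c * (- 1ℚ) + β          <⟨ p<p+q (c * (- 1ℚ) + β) (positive⁻¹ 1ℚ) ⟩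
  c * (- 1ℚ) + β + 1ℚ     ≡⟨ solve 2 (λ c b → c :* con (- 1ℚ) :+ b :+ con 1ℚ := b :- c :+ con 1ℚ :+ con 0ℚ) refl c β ⟩
  totalValue [ Y ]        ≤⟨ fits⇒totalValue≤optGain {[ Y ]} ⊆-refl ≤-refl ⟩
  optGain [ Y ]           ∎)
  where
  open Data.Rational.Solver.+-*-Solver
  0<W : 0ℚ < (β - c) + 1ℚ
  0<W = <-trans (p<q⇒0<q-p (≤-<-trans c≤0 0<β)) (p<p+q (β - c) (positive⁻¹ 1ℚ))
  Y : Item
  Y = item 1ℚ ((β - c) + 1ℚ) (positive⁻¹ 1ℚ) ≤-refl 0<W
  gain≥-1 : - 1ℚ ≤ gain α A [ Y ]
  gain≥-1 = ≤-trans (neg-antimono-≤ (≤-trans (≤-reflexive (*-identityʳ α)) α≤1))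
                    (gain≥-α*totalSize A [ Y ] 0≤α)

theorem2 : (α : ℚ) → 0ℚ < α → α ≤ 1ℚ →
    (A : Algorithm) → Valid A →
    (c : ℚ) → c < 1ℚ + 1ℚ →
    (β : ℚ) → 0ℚ < β →
    ∃[ S ] (optGain S > c * gain α A S + β)
theorem2 α 0<α α≤1 A valid c c<2 β 0<β = [ small-c , large-c ]′ (≤-total c 0ℚ)
  where
  small-c : c ≤ 0ℚ → ∃[ S ] (optGain S > c * gain α A S + β)
  small-c c≤0 = nonPositive-ratio A (<⇒≤ 0<α) α≤1 c≤0 0<β
  large-c : 0ℚ ≤ c → ∃[ S ] (optGain S > c * gain α A S + β)
  large-c 0≤c =
    let V , 0<V , β<V , cV+β<2V = value-scale c<2 0<β
        S , outcome = Adversary.adversary V 0<V A valid 0<α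
    in S , outcomes⇒c*g+β<o 0≤c β<V cV+β<2V outcome
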